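{- For $n\ge1$, $$|\Pi_n(134/2)|=1+\sum_{k=1}^{\lfloor n/2\rfloor}\sum_{f=0}^{n-2k}\binom{n-f-k-1}{k-1}\binom{2k+f}{f}(2k-1)!!,$$ where $(2k-1)!!=(2k)!/(2^kk!)$ is the number of perfect matchings of a $2k$-element set.
   Context: The standardization of a set partition of a finite set $S\subset\mathbb{Z}_{>0}$ replaces the $i$-th smallest element of $S$ by $i$. A set partition $\pi$ of $[n]$ contains $\tau\vdash[k]$ if for some $S\subseteq[n]$ the standardization of the restriction of $\pi$ to $S$ is $\tau$; otherwise it avoids $\tau$. $\Pi_n(\tau)$ is the set of partitions of $[n]$ avoiding $\tau$. $134/2$ is the partition of $[4]$ with blocks $\{1,3,4\},\{2\}$. -}

module Defs where

open import Data.Nat using (ℕ; zero; suc; _+_; _*_; _∸_; _/_)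
open import Data.Nat.Combinatorics using (_C_)
open import Data.Bool using (Bool; true; false)
open import Data.Fin using (Fin; zero; suc) renaming (_<_ to _<ᶠ_)
open import Data.Vec using (Vec; lookup)
open import Data.List using (List; length; map; upTo; applyUpTo)
open import Data.Nat.ListAction using (sum)
open import Data.List.Relation.Unary.All using (All)
open import Data.List.Relation.Unary.Unique.Propositional using (Unique)
open import Data.List.Membership.Propositional using (_∈_)
open import Data.Product using (Σ; _×_; ∃)
open import Relation.Binary.PropositionalEquality using (_≡_)
open import Relation.Nullary using (¬_)

-- A set partition of [n] = {0,…,n-1} is encoded by its "same block" relation,
-- stored as an n×n Boolean matrix (so that distinct partitions are distinct
-- matrices under ≡).
Mat : ℕ → Set
Mat n = Vec (Vec Bool n) n

rel : ∀ {n} → Mat n → Fin n → Fin n → Bool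
rel M i j = lookup (lookup M i) j

record IsSetPartition {n : ℕ} (M : Mat n) : Set where
  field
    refl  : ∀ i → rel M i i ≡ true
    sym   : ∀ i j → rel M i j ≡ true → rel M j i ≡ true
    trans : ∀ i j k → rel M i j ≡ true → rel M j k ≡ true → rel M i k ≡ true

-- The pattern 134/2 on [4] (0-indexed: blocks {0,2,3}, {1}).
τ : Fin 4 → Fin 4 → Bool
τ (suc zero) (suc zero) = true
τ (suc zero) _          = false
τ _          (suc zero) = false
τ _          _          = true

-- π contains a pattern σ on [k] iff there is a k-subset S of [n], given by its
-- increasing enumeration φ : Fin k → Fin n (the inverse of standardization),
-- such that the restriction of π to S, standardized, is σ.
Contains : ∀ {n k} → Mat n → (Fin k → Fin k → Bool) → Set
Contains {n} {k} M σ =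
  Σ (Fin k → Fin n) λ φ →
    (∀ i j → i <ᶠ j → φ i <ᶠ φ j) × (∀ i j → rel M (φ i) (φ j) ≡ σ i j)

Avoids : ∀ {n k} → Mat n → (Fin k → Fin k → Bool) → Set
Avoids M σ = ¬ Contains M σ

HasCard : {A : Set} → (A → Set) → ℕ → Set
HasCard {A} P N =
  Σ (List A) λ L → Unique L × All P L × (∀ x → P x → x ∈ L) × length L ≡ N

-- (2k-1)!! with (-1)!! = 1
dfact : ℕ → ℕ
dfact zero    = 1
dfact (suc k) = (2 * k + 1) * dfact k

formula : ℕ → ℕ
formula n = 1 + sum (map (λ k →
               sum (map (λ f → ((n ∸ f ∸ k ∸ 1) C (k ∸ 1)) * ((2 * k + f) C f) * dfact k)
                        (upTo (suc (n ∸ 2 * k)))))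
             (applyUpTo suc (n / 2)))

module Submission where

-- A 134/2-avoiding partition of {0, …, n-1} arises from its restriction to {1, …, n-1} by adding 0
-- as a singleton, by pairing 0 with a singleton, or by putting 0 into the block of 1; the last
-- choice is forced once the block of 0 has three elements, since otherwise 0, 1 and two later
-- elements of that block form 134/2. Recording these choices gives codes that decode bijectively
-- onto the avoiding partitions. With k blocks of size at least two, f singletons and r = n - 2k - f
-- uses of the third choice, the codes satisfy the recurrences of C(k+r-1, k-1) · C(2k+f, f) · (2k-1)!!,
-- the summand of the formula.

open import Defs
open import Data.Bool using (Bool; true; false)
open import Data.Bool.Properties as Bool using (⇔→≡; ¬-not)
open import Data.Empty using (⊥; ⊥-elim)
open import Data.Fin using (Fin; zero; suc; punchIn; punchOut) renaming (_<_ to _<ᶠ_)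
open import Data.Fin.Properties as Fin using (punchIn-injective; punchInᵢ≢i; punchIn-punchOut; any?)
open import Data.List using (List; []; _∷_; _++_; map; length; allFin; cartesianProductWith; upTo; applyUpTo)
open import Data.List.Properties using (length-++; length-map; length-tabulate; map-cong; map-cong-local)
open import Data.List.Membership.Propositional using (_∈_)
open import Data.List.Membership.Propositional.Properties
open import Data.List.Relation.Unary.All as All using ([]; _∷_)
open import Data.List.Relation.Unary.Any using (here; there)
open import Data.List.Relation.Unary.Unique.Propositional using (Unique; []; _∷_)
import Data.List.Relation.Unary.Unique.Propositional.Properties as Unique
open import Data.Nat using (ℕ; zero; suc; _+_; _*_; _∸_; _/_; _≥_; _≤_; z≤n; s≤s; z<s; s<s; s<s⁻¹)
open import Data.Nat.Combinatorics using (_C_; nCn≡1; nCk+nC[k+1]≡[n+1]C[k+1])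
open import Data.Nat.DivMod using (m/n*n≤m; m*n/n≡m; /-monoˡ-≤)
open import Data.Nat.ListAction using (sum)
open import Data.Nat.Properties
open import Data.Nat.Tactic.RingSolver using (solve-∀)
open import Data.Product using (Σ; _×_; _,_; proj₁; proj₂; ∃)
open import Data.Sum using (_⊎_; inj₁; inj₂)
open import Data.Vec using (lookup; tabulate)
open import Data.Vec.Properties using (lookup∘tabulate; tabulate∘lookup; tabulate-cong)
import Data.Vec.Functional as Vector
open import Function using (case_of_; _on_; _∘_; id; mk⇔)
open import Relation.Binary.Definitions using (tri<; tri≈; tri>)
open import Relation.Binary.PropositionalEquality
open import Relation.Binary.Structures using (IsEquivalence)
import Relation.Binary.Construct.On as On
open import Relation.Nullary using (¬_; yes; no; ¬?)
open import Relation.Nullary.Decidable using (_×-dec_)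

module _ {A : Set} {B : A → Set} where

  private
    pair : (a : A) → B a → Σ A B
    pair a = a ,_

  dependentProduct : (xs : List A) → ((a : A) → List (B a)) → List (Σ A B)
  dependentProduct []       ys = []
  dependentProduct (a ∷ xs) ys = map (pair a) (ys a) ++ dependentProduct xs ys

  ∈-dependentProduct⁺ : ∀ {xs : List A} (ys : (a : A) → List (B a)) {a b} →
                        a ∈ xs → b ∈ ys a → (a , b) ∈ dependentProduct xs ys
  ∈-dependentProduct⁺ ys (here refl) b∈ = ∈-++⁺ˡ (∈-map⁺ (pair _) b∈)
  ∈-dependentProduct⁺ ys (there {x = a} a∈) b∈ =
    ∈-++⁺ʳ (map (pair a) (ys a)) (∈-dependentProduct⁺ ys a∈ b∈)

  ∈-dependentProduct⁻ : ∀ (xs : List A) {ys : (a : A) → List (B a)} {p} →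
                        p ∈ dependentProduct xs ys → proj₁ p ∈ xs
  ∈-dependentProduct⁻ (a ∷ xs) {ys} p∈ with ∈-++⁻ (map (pair a) (ys a)) p∈
  ... | inj₁ p∈ys with _ , _ , refl ← ∈-map⁻ (pair a) p∈ys = here refl
  ... | inj₂ p∈rest = there (∈-dependentProduct⁻ xs p∈rest)

  dependentProduct-unique : ∀ {xs : List A} {ys : (a : A) → List (B a)} →
                            Unique xs → (∀ a → Unique (ys a)) → Unique (dependentProduct xs ys)
  dependentProduct-unique {xs = []}     []          _ = []
  dependentProduct-unique {xs = a ∷ xs} {ys} (a∉xs ∷ xs!) ys! =
    Unique.++⁺ (Unique.map⁺ ,-injectiveʳ (ys! a)) (dependentProduct-unique xs! ys!) disjoint
    where
    ,-injectiveʳ : ∀ {b b′ : B a} → (a , b) ≡ (a , b′) → b ≡ b′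
    ,-injectiveʳ refl = refl
    disjoint : ∀ {p} → p ∈ map (pair a) (ys a) × p ∈ dependentProduct xs ys → ⊥
    disjoint (p∈ys , p∈rest) with _ , _ , refl ← ∈-map⁻ (pair a) p∈ys =
      All.lookup a∉xs (∈-dependentProduct⁻ xs p∈rest) refl

  length-dependentProduct : ∀ (xs : List A) (ys : (a : A) → List (B a)) →
                            length (dependentProduct xs ys) ≡ sum (map (λ a → length (ys a)) xs)
  length-dependentProduct []       ys = refl
  length-dependentProduct (a ∷ xs) ys = begin
    length (map (pair a) (ys a) ++ dependentProduct xs ys)
      ≡⟨ length-++ (map (pair a) (ys a)) ⟩
    length (map (pair a) (ys a)) + length (dependentProduct xs ys)
      ≡⟨ cong₂ _+_ (length-map (pair a) (ys a)) (length-dependentProduct xs ys) ⟩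
    length (ys a) + sum (map (λ a → length (ys a)) xs)  ∎
    where open ≡-Reasoning

length-cartesianProductWith : ∀ {A B C : Set} (g : A → B → C) xs ys →
                              length (cartesianProductWith g xs ys) ≡ length xs * length ys
length-cartesianProductWith g []       ys = refl
length-cartesianProductWith g (x ∷ xs) ys = begin
  length (map (g x) ys ++ cartesianProductWith g xs ys)
    ≡⟨ length-++ (map (g x) ys) ⟩
  length (map (g x) ys) + length (cartesianProductWith g xs ys)
    ≡⟨ cong₂ _+_ (length-map (g x) ys) (length-cartesianProductWith g xs ys) ⟩
  length ys + length xs * length ys  ∎
  where open ≡-Reasoning

length-empty : ∀ {A : Set} → ¬ A → (xs : List A) → length xs ≡ 0
length-empty ¬a []      = refl
length-empty ¬a (x ∷ _) = ⊥-elim (¬a x)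

-- Binomial coefficients and matchings

pascal : ℕ → ℕ → ℕ
pascal zero    b       = 1
pascal (suc a) zero    = 1
pascal (suc a) (suc b) = pascal a (suc b) + pascal (suc a) b

C-pascal : ∀ a b → (a + b) C a ≡ pascal a b
C-pascal zero    b       = refl
C-pascal (suc a) zero    = trans (cong (λ m → suc m C suc a) (+-identityʳ a)) (nCn≡1 (suc a))
C-pascal (suc a) (suc b) = begin
  suc (a + suc b) C suc a                   ≡⟨ nCk+nC[k+1]≡[n+1]C[k+1] (a + suc b) a ⟨
  (a + suc b) C a + (a + suc b) C suc a     ≡⟨ cong (λ m → (a + suc b) C a + m C suc a) (+-suc a b) ⟩
  (a + suc b) C a + (suc a + b) C suc a     ≡⟨ cong₂ _+_ (C-pascal a (suc b)) (C-pascal (suc a) b) ⟩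
  pascal a (suc b) + pascal (suc a) b       ∎
  where open ≡-Reasoning

pascal-0ʳ : ∀ a → pascal a 0 ≡ 1
pascal-0ʳ zero    = refl
pascal-0ʳ (suc a) = refl

pascal-1ˡ : ∀ b → pascal 1 b ≡ suc b
pascal-1ˡ zero    = refl
pascal-1ˡ (suc b) = cong suc (pascal-1ˡ b)

pascal-1ʳ : ∀ a → pascal a 1 ≡ suc a
pascal-1ʳ zero    = refl
pascal-1ʳ (suc a) = trans (cong (_+ 1) (pascal-1ʳ a)) (+-comm (suc a) 1)

pascal-absorb : ∀ a b → suc a * pascal (suc a) b ≡ suc b * pascal a (suc b)
pascal-absorb zero    b       = trans (+-identityʳ (pascal 1 b)) (trans (pascal-1ˡ b) (sym (*-identityʳ (suc b))))
pascal-absorb (suc a) zero    = trans (*-identityʳ (suc (suc a))) (sym (trans (+-identityʳ _) (pascal-1ʳ (suc a))))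
pascal-absorb (suc a) (suc b) = begin
  suc (suc a) * (x + pascal (suc (suc a)) b)                ≡⟨ *-distribˡ-+ (suc (suc a)) x _ ⟩
  suc (suc a) * x + suc (suc a) * pascal (suc (suc a)) b    ≡⟨ cong (suc (suc a) * x +_) (pascal-absorb (suc a) b) ⟩
  suc (suc a) * x + suc b * x                               ≡⟨ regroup a b x ⟩
  suc a * x + suc (suc b) * x                               ≡⟨ cong (_+ suc (suc b) * x) (pascal-absorb a (suc b)) ⟩
  suc (suc b) * pascal a (suc (suc b)) + suc (suc b) * x    ≡⟨ *-distribˡ-+ (suc (suc b)) (pascal a (suc (suc b))) x ⟨
  suc (suc b) * (pascal a (suc (suc b)) + x)                ∎
  where
  open ≡-Reasoning
  x = pascal (suc a) (suc b)
  regroup : ∀ a b x → (2 + a) * x + (1 + b) * x ≡ (1 + a) * x + (2 + b) * x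
  regroup = solve-∀

-- The number of matchings with k edges on 2k + f points: C(2k + f, f) · (2k − 1)!!.
matchings : ℕ → ℕ → ℕ
matchings k f = pascal f (2 * k) * dfact k

matchings-suc-zero : ∀ k → matchings (suc k) 0 ≡ matchings k 1
matchings-suc-zero k = begin
  1 * ((2 * k + 1) * dfact k)          ≡⟨ *-identityˡ _ ⟩
  (2 * k + 1) * dfact k                ≡⟨ cong (_* dfact k) (+-comm (2 * k) 1) ⟩
  suc (2 * k) * dfact k                ≡⟨ cong (_* dfact k) (pascal-1ˡ (2 * k)) ⟨
  pascal 1 (2 * k) * dfact k           ∎
  where open ≡-Reasoning

matchings-suc-suc : ∀ k g → matchings (suc k) (suc g) ≡ matchings (suc k) g + suc (suc g) * matchings k (suc (suc g))
matchings-suc-suc k g = begin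
  pascal (suc g) (2 * suc k) * d
    ≡⟨ cong (λ m → pascal (suc g) m * d) 2[1+k]≡2+2k ⟩
  (pascal g (2 + 2 * k) + pascal (suc g) (suc (2 * k))) * d
    ≡⟨ *-distribʳ-+ d (pascal g (2 + 2 * k)) _ ⟩
  pascal g (2 + 2 * k) * d + pascal (suc g) (suc (2 * k)) * d
    ≡⟨ cong₂ _+_ (cong (λ m → pascal g m * d) (sym 2[1+k]≡2+2k))
                 (shuffle (pascal (suc g) (suc (2 * k))) (2 * k) (dfact k)) ⟩
  matchings (suc k) g + suc (2 * k) * pascal (suc g) (suc (2 * k)) * dfact k
    ≡⟨ cong (λ m → matchings (suc k) g + m * dfact k) (pascal-absorb (suc g) (2 * k)) ⟨
  matchings (suc k) g + suc (suc g) * pascal (suc (suc g)) (2 * k) * dfact k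
    ≡⟨ cong (matchings (suc k) g +_) (*-assoc (suc (suc g)) (pascal (suc (suc g)) (2 * k)) (dfact k)) ⟩
  matchings (suc k) g + suc (suc g) * matchings k (suc (suc g))  ∎
  where
  open ≡-Reasoning
  d = dfact (suc k)
  2[1+k]≡2+2k : 2 * suc k ≡ 2 + 2 * k
  2[1+k]≡2+2k = *-suc 2 k
  shuffle : ∀ x t y → x * ((t + 1) * y) ≡ (1 + t) * x * y
  shuffle = solve-∀

private
  variable
    n k f : ℕ
    e : Bool

-- Code n k f e: a 134/2-avoiding partition of {0, …, n-1} with k blocks of size at least two and
-- f singletons, built by adding 0 to a partition of {1, …, n-1}; joinSingleton c i pairs 0 with
-- the i-th singleton of c. The flag e records whether 0 is a singleton (true for n = 0).
data Code : ℕ → ℕ → ℕ → Bool → Set where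
  nil           : Code 0 0 0 true
  singleton     : Code n k f e → Code (suc n) k (suc f) true
  joinSingleton : Code n k (suc f) e → Fin (suc f) → Code (suc n) (suc k) f false
  joinNext      : Code (suc n) k f false → Code (suc (suc n)) k f false

CodeOf : ℕ → ℕ → ℕ → Set
CodeOf n k f = Σ Bool (Code n k f)

booleans : List Bool
booleans = true ∷ false ∷ []

mutual
  codes : ∀ n k f e → List (Code n k f e)
  codes zero    zero    zero    true  = nil ∷ []
  codes zero    zero    zero    false = []
  codes zero    zero    (suc f) e     = []
  codes zero    (suc k) f       e     = []
  codes (suc n) k       f       false = joinSingletons n k f ++ joinNexts n k f
  codes (suc n) k       zero    true  = []
  codes (suc n) k       (suc f) true  = map (λ (_ , c) → singleton c) (codesOf n k f)

  codesOf : ∀ n k f → List (CodeOf n k f)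
  codesOf n k f = dependentProduct booleans (codes n k f)

  joinSingletons : ∀ n k f → List (Code (suc n) k f false)
  joinSingletons n zero    f = []
  joinSingletons n (suc k) f = cartesianProductWith (λ (_ , c) → joinSingleton c) (codesOf n k (suc f)) (allFin (suc f))

  joinNexts : ∀ n k f → List (Code (suc n) k f false)
  joinNexts zero    k f = []
  joinNexts (suc n) k f = map joinNext (codes (suc n) k f false)

∈-booleans : ∀ b → b ∈ booleans
∈-booleans true  = here refl
∈-booleans false = there (here refl)

booleans-unique : Unique booleans
booleans-unique = ((λ ()) ∷ []) ∷ [] ∷ []

mutual
  codes-complete : (c : Code n k f e) → c ∈ codes n k f e
  codes-complete nil                 = here refl
  codes-complete (singleton c)       = ∈-map⁺ _ (codesOf-complete c)
  codes-complete (joinSingleton c i) = ∈-++⁺ˡ (∈-cartesianProductWith⁺ _ (codesOf-complete c) (∈-allFin i))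
  codes-complete (joinNext {n} {k} {f} c) =
    ∈-++⁺ʳ (joinSingletons (suc n) k f) (∈-map⁺ joinNext (codes-complete c))

  codesOf-complete : (c : Code n k f e) → (e , c) ∈ codesOf n k f
  codesOf-complete {n} {k} {f} {e} c = ∈-dependentProduct⁺ (codes n k f) (∈-booleans e) (codes-complete c)

joinSingletons-joinNexts-disjoint : ∀ n k f {c} → c ∈ joinSingletons n k f → c ∈ joinNexts n k f → ⊥
joinSingletons-joinNexts-disjoint (suc n) (suc k) f c∈s c∈n
  with _ , _ , _ , _ , refl ← ∈-cartesianProductWith⁻ _ (codesOf (suc n) k (suc f)) (allFin (suc f)) c∈s
     | _ , _ , ()        ← ∈-map⁻ joinNext c∈n

mutual
  codes-unique : ∀ n k f e → Unique (codes n k f e)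
  codes-unique zero    zero    zero    true  = [] ∷ []
  codes-unique zero    zero    zero    false = []
  codes-unique zero    zero    (suc f) e     = []
  codes-unique zero    (suc k) f       e     = []
  codes-unique (suc n) k       f       false =
    Unique.++⁺ (joinSingletons-unique n k f) (joinNexts-unique n k f)
      (λ (c∈s , c∈n) → joinSingletons-joinNexts-disjoint n k f c∈s c∈n)
  codes-unique (suc n) k       zero    true  = []
  codes-unique (suc n) k       (suc f) true  = Unique.map⁺ (λ { {_ , _} {_ , _} refl → refl }) (codesOf-unique n k f)

  codesOf-unique : ∀ n k f → Unique (codesOf n k f)
  codesOf-unique n k f = dependentProduct-unique booleans-unique (codes-unique n k f)

  joinSingletons-unique : ∀ n k f → Unique (joinSingletons n k f)
  joinSingletons-unique n zero    f = []
  joinSingletons-unique n (suc k) f =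
    Unique.cartesianProductWith⁺ _ (λ { {_ , _} {_ , _} refl → refl , refl })
      (codesOf-unique n k (suc f)) (Unique.allFin⁺ (suc f))

  joinNexts-unique : ∀ n k f → Unique (joinNexts n k f)
  joinNexts-unique zero    k f = []
  joinNexts-unique (suc n) k f = Unique.map⁺ (λ { refl → refl }) (codes-unique (suc n) k f false)

-- Counting codes

2[1+k]+f≡1+[2k+1+f] : ∀ k f → 2 * suc k + f ≡ suc (2 * k + suc f)
2[1+k]+f≡1+[2k+1+f] = solve-∀

size-bound : Code n k f e → 2 * k + f ≤ n
size-bound nil = z≤n
size-bound (singleton {n} {k} {f} c) = subst (_≤ suc n) (sym (+-suc (2 * k) f)) (s≤s (size-bound c))
size-bound (joinSingleton {n} {k} {f} c _) = subst (_≤ suc n) (sym (2[1+k]+f≡1+[2k+1+f] k f)) (s≤s (size-bound c))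
size-bound (joinNext c) = m≤n⇒m≤1+n (size-bound c)

pairFree : Code n 0 f e → n ≡ f × e ≡ true
pairFree nil           = refl , refl
pairFree (singleton c) = cong suc (proj₁ (pairFree c)) , refl
pairFree (joinNext c) with () ← proj₂ (pairFree c)

countWith : ℕ → ℕ → ℕ → Bool → ℕ
countWith n k f e = length (codes n k f e)

count : ℕ → ℕ → ℕ → ℕ
count n k f = length (codesOf n k f)

count-split : ∀ n k f → count n k f ≡ countWith n k f true + countWith n k f false
count-split n k f = trans (length-dependentProduct booleans (codes n k f))
                          (cong (countWith n k f true +_) (+-identityʳ _))

countWith-true : ∀ {n m} k f → n ≡ suc m → countWith n k (suc f) true ≡ count m k f
countWith-true {m = m} k f refl = length-map _ (codesOf m k f)

countWith-false : ∀ {n m} k f → n ≡ suc m →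
                  countWith n (suc k) f false ≡ count m k (suc f) * suc f + length (joinNexts m (suc k) f)
countWith-false {m = m} k f refl = begin
  length (joinSingletons m (suc k) f ++ joinNexts m (suc k) f)
    ≡⟨ length-++ (joinSingletons m (suc k) f) ⟩
  length (joinSingletons m (suc k) f) + length (joinNexts m (suc k) f)
    ≡⟨ cong (_+ length (joinNexts m (suc k) f)) (length-cartesianProductWith _ (codesOf m k (suc f)) (allFin (suc f))) ⟩
  count m k (suc f) * length (allFin (suc f)) + length (joinNexts m (suc k) f)
    ≡⟨ cong (λ l → count m k (suc f) * l + length (joinNexts m (suc k) f)) (length-tabulate (λ i → i)) ⟩
  count m k (suc f) * suc f + length (joinNexts m (suc k) f)  ∎
  where open ≡-Reasoning

length-joinNexts : ∀ {n m} k f → n ≡ suc m → length (joinNexts n k f) ≡ countWith n k f false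
length-joinNexts k f refl = length-map joinNext (codes _ k f false)

length-joinNexts-tight : ∀ k f → length (joinNexts (2 * k + suc f) (suc k) f) ≡ 0
length-joinNexts-tight k f =
  trans (length-joinNexts (suc k) f (+-suc (2 * k) f)) (length-empty too-large (codes _ (suc k) f false))
  where
  too-large : ¬ Code (2 * k + suc f) (suc k) f false
  too-large c = <-irrefl refl (≤-trans (≤-reflexive (sym (2[1+k]+f≡1+[2k+1+f] k f))) (size-bound c))

count-pairFree : ∀ f → count f 0 f ≡ 1
count-pairFree f = trans (count-split f 0 f) (cong₂ _+_ (true-part f) no-false)
  where
  true-part : ∀ f → countWith f 0 f true ≡ 1
  true-part zero    = refl
  true-part (suc f) = trans (countWith-true {m = f} 0 f refl) (count-pairFree f)
  no-false : countWith f 0 f false ≡ 0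
  no-false = length-empty (λ c → case proj₂ (pairFree c) of λ ()) (codes f 0 f false)

count-pairFree-large : ∀ {n} r f → n ≡ suc r + f → count n 0 f ≡ 0
count-pairFree-large r f eq =
  length-empty (λ (_ , c) → m+1+n≢n r (trans (+-suc r f) (trans (sym eq) (proj₁ (pairFree c))))) (codesOf _ 0 f)

mutual
  count-closed : ∀ n r k f → n ≡ r + 2 * suc k + f → count n (suc k) f ≡ pascal k r * matchings (suc k) f
  count-closed n r k zero eq = begin
    count n (suc k) 0
      ≡⟨ count-split n (suc k) 0 ⟩
    countWith n (suc k) 0 true + countWith n (suc k) 0 false
      ≡⟨ cong₂ _+_ (length-empty (λ ()) (codes n (suc k) 0 true)) (countWith-false-closed n r k 0 eq) ⟩
    pascal k r * (1 * matchings k 1)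
      ≡⟨ cong (pascal k r *_) (trans (*-identityˡ _) (sym (matchings-suc-zero k))) ⟩
    pascal k r * matchings (suc k) 0  ∎
    where open ≡-Reasoning
  count-closed n r k (suc g) eq = begin
    count n (suc k) (suc g)
      ≡⟨ count-split n (suc k) (suc g) ⟩
    countWith n (suc k) (suc g) true + countWith n (suc k) (suc g) false
      ≡⟨ cong₂ _+_ (trans (countWith-true (suc k) g (trans eq (+-suc _ g))) (count-closed _ r k g refl))
                   (countWith-false-closed n r k (suc g) eq) ⟩
    pascal k r * matchings (suc k) g + pascal k r * (suc (suc g) * matchings k (suc (suc g)))
      ≡⟨ *-distribˡ-+ (pascal k r) _ _ ⟨
    pascal k r * (matchings (suc k) g + suc (suc g) * matchings k (suc (suc g)))
      ≡⟨ cong (pascal k r *_) (matchings-suc-suc k g) ⟨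
    pascal k r * matchings (suc k) (suc g)  ∎
    where open ≡-Reasoning

  countWith-false-closed : ∀ n r k f → n ≡ r + 2 * suc k + f →
                           countWith n (suc k) f false ≡ pascal k r * (suc f * matchings k (suc f))
  countWith-false-closed n r k f eq = trans (countWith-false k f (trans eq (shift r k f))) (joinCount-closed r k f)
    where
    shift : ∀ r k f → r + 2 * (1 + k) + f ≡ 1 + (r + 2 * k + (1 + f))
    shift = solve-∀

  -- 0 is paired with one of the suc f singletons, or joins the block of 1 (impossible when r = 0).
  joinCount-closed : ∀ r k f → count (r + 2 * k + suc f) k (suc f) * suc f + length (joinNexts (r + 2 * k + suc f) (suc k) f)
                               ≡ pascal k r * (suc f * matchings k (suc f))
  joinCount-closed zero zero f = begin
    count (suc f) 0 (suc f) * suc f + length (joinNexts (suc f) 1 f)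
      ≡⟨ cong₂ (λ c j → c * suc f + j) (count-pairFree (suc f)) (length-joinNexts-tight 0 f) ⟩
    1 * suc f + 0
      ≡⟨ simplify f ⟩
    1 * (suc f * (1 * 1))  ∎
    where
    open ≡-Reasoning
    simplify : ∀ f → 1 * (1 + f) + 0 ≡ 1 * ((1 + f) * (1 * 1))
    simplify = solve-∀
  joinCount-closed (suc r) zero f = begin
    count m 0 (suc f) * suc f + length (joinNexts m 1 f)
      ≡⟨ cong₂ (λ c j → c * suc f + j) (count-pairFree-large r (suc f) (cong suc (cong (_+ suc f) (+-identityʳ r))))
                                       (length-joinNexts {m = r + 2 * 0 + suc f} 1 f refl) ⟩
    countWith m 1 f false
      ≡⟨ countWith-false-closed m r 0 f (shift r f) ⟩
    pascal 0 r * (suc f * matchings 0 (suc f))  ∎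
    where
    open ≡-Reasoning
    m = suc r + 2 * 0 + suc f
    shift : ∀ r f → (1 + r) + 2 * 0 + (1 + f) ≡ r + 2 * (1 + 0) + f
    shift = solve-∀
  joinCount-closed zero (suc k) f = begin
    count m (suc k) (suc f) * suc f + length (joinNexts m (suc (suc k)) f)
      ≡⟨ cong₂ (λ c j → c * suc f + j) (count-closed m 0 k (suc f) refl) (length-joinNexts-tight (suc k) f) ⟩
    pascal k 0 * μ * suc f + 0
      ≡⟨ cong (λ p → p * μ * suc f + 0) (pascal-0ʳ k) ⟩
    1 * μ * suc f + 0
      ≡⟨ simplify μ (suc f) ⟩
    1 * (suc f * μ)
      ≡⟨ cong (_* (suc f * μ)) (pascal-0ʳ (suc k)) ⟨
    pascal (suc k) 0 * (suc f * μ)  ∎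
    where
    open ≡-Reasoning
    m = 0 + 2 * suc k + suc f
    μ = matchings (suc k) (suc f)
    simplify : ∀ x s → 1 * x * s + 0 ≡ 1 * (s * x)
    simplify = solve-∀
  joinCount-closed (suc r) (suc k) f = begin
    count m (suc k) (suc f) * suc f + length (joinNexts m (suc (suc k)) f)
      ≡⟨ cong₂ (λ c j → c * suc f + j) (count-closed m (suc r) k (suc f) refl)
                                       (length-joinNexts {m = r + 2 * suc k + suc f} (suc (suc k)) f refl) ⟩
    pascal k (suc r) * μ * suc f + countWith m (suc (suc k)) f false
      ≡⟨ cong (pascal k (suc r) * μ * suc f +_) (countWith-false-closed m r (suc k) f (shift r k f)) ⟩
    pascal k (suc r) * μ * suc f + pascal (suc k) r * (suc f * μ)
      ≡⟨ collect (pascal k (suc r)) (pascal (suc k) r) μ (suc f) ⟩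
    (pascal k (suc r) + pascal (suc k) r) * (suc f * μ)  ∎
    where
    open ≡-Reasoning
    m = suc r + 2 * suc k + suc f
    μ = matchings (suc k) (suc f)
    shift : ∀ r k f → (1 + r) + 2 * (1 + k) + (1 + f) ≡ r + 2 * (1 + (1 + k)) + f
    shift = solve-∀
    collect : ∀ x y z s → x * z * s + y * (s * z) ≡ (x + y) * (s * z)
    collect = solve-∀

k≤n/2⇒2k≤n : ∀ {k n} → k ≤ n / 2 → 2 * k ≤ n
k≤n/2⇒2k≤n {k} {n} k≤n/2 = ≤-trans (*-monoʳ-≤ 2 k≤n/2) (subst (_≤ n) (*-comm (n / 2) 2) (m/n*n≤m n 2))

2k≤n⇒k≤n/2 : ∀ {k n} → 2 * k ≤ n → k ≤ n / 2
2k≤n⇒k≤n/2 {k} {n} 2k≤n = subst (_≤ n / 2) (m*n/n≡m k 2) (/-monoˡ-≤ 2 (subst (_≤ n) (*-comm 2 k) 2k≤n))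

AnyCode : ℕ → Set
AnyCode n = Σ ℕ λ k → Σ ℕ λ f → CodeOf n k f

-- The ranges of the double sum in formula; with no pairs only f = n is possible, giving the leading 1.
singletonCounts : ℕ → ℕ → List ℕ
singletonCounts n zero    = n ∷ []
singletonCounts n (suc k) = upTo (suc (n ∸ 2 * suc k))

allCodes : ∀ n → List (AnyCode n)
allCodes n = dependentProduct (upTo (suc (n / 2))) λ k → dependentProduct (singletonCounts n k) (codesOf n k)

allCodes-complete : ∀ n (C : AnyCode n) → C ∈ allCodes n
allCodes-complete n (k , f , e , c) =
  ∈-dependentProduct⁺ _ (∈-upTo⁺ (s≤s (2k≤n⇒k≤n/2 2k≤n)))
    (∈-dependentProduct⁺ (codesOf n k) (f∈ k c) (codesOf-complete c))
  where
  2k≤n : 2 * k ≤ n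
  2k≤n = m+n≤o⇒m≤o (2 * k) (size-bound c)
  f∈ : ∀ k → Code n k f e → f ∈ singletonCounts n k
  f∈ zero    c with refl ← proj₁ (pairFree c) = here refl
  f∈ (suc k) c = ∈-upTo⁺ (s≤s (m+n≤o⇒m≤o∸n f (subst (_≤ n) (+-comm (2 * suc k) f) (size-bound c))))

allCodes-unique : ∀ n → Unique (allCodes n)
allCodes-unique n = dependentProduct-unique (Unique.upTo⁺ (suc (n / 2)))
  λ k → dependentProduct-unique (singletonCounts-unique k) (codesOf-unique n k)
  where
  singletonCounts-unique : ∀ k → Unique (singletonCounts n k)
  singletonCounts-unique zero    = [] ∷ []
  singletonCounts-unique (suc k) = Unique.upTo⁺ (suc (n ∸ 2 * suc k))

summand : ℕ → ℕ → ℕ → ℕ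
summand n k f = ((n ∸ f ∸ k ∸ 1) C (k ∸ 1)) * ((2 * k + f) C f) * dfact k

count-summand : ∀ n r k f → n ≡ r + 2 * suc k + f → count n (suc k) f ≡ summand n (suc k) f
count-summand n r k f refl = begin
  count n (suc k) f
    ≡⟨ count-closed n r k f refl ⟩
  pascal k r * (pascal f (2 * suc k) * dfact (suc k))
    ≡⟨ *-assoc (pascal k r) _ _ ⟨
  pascal k r * pascal f (2 * suc k) * dfact (suc k)
    ≡⟨ cong₂ (λ p q → p * q * dfact (suc k)) (sym (trans (cong (_C k) (pairs-left r k f)) (C-pascal k r)))
                                             (sym (trans (cong (_C f) (+-comm (2 * suc k) f)) (C-pascal f (2 * suc k)))) ⟩
  summand n (suc k) f  ∎
  where
  open ≡-Reasoning
  pairs-left : ∀ r k f → r + 2 * suc k + f ∸ f ∸ suc k ∸ 1 ≡ k + r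
  pairs-left r k f = begin
    r + 2 * suc k + f ∸ f ∸ suc k ∸ 1      ≡⟨ cong (λ m → m ∸ suc k ∸ 1) (m+n∸n≡m (r + 2 * suc k) f) ⟩
    r + 2 * suc k ∸ suc k ∸ 1              ≡⟨ cong (λ m → m ∸ suc k ∸ 1) (regroup r k) ⟩
    suc (k + r) + suc k ∸ suc k ∸ 1        ≡⟨ cong (_∸ 1) (m+n∸n≡m (suc (k + r)) (suc k)) ⟩
    k + r                                  ∎
    where
    regroup : ∀ r k → r + 2 * (1 + k) ≡ (1 + (k + r)) + (1 + k)
    regroup = solve-∀

length-allCodes : ∀ n → length (allCodes n) ≡ formula n
length-allCodes n = begin
  length (allCodes n)
    ≡⟨ length-dependentProduct (upTo (suc (n / 2))) (λ k → dependentProduct (singletonCounts n k) (codesOf n k)) ⟩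
  sum (map (λ k → length (dependentProduct (singletonCounts n k) (codesOf n k))) (upTo (suc (n / 2))))
    ≡⟨ cong sum (map-cong (λ k → length-dependentProduct (singletonCounts n k) (codesOf n k)) (upTo (suc (n / 2)))) ⟩
  (count n 0 n + 0) + sum (map (λ k → sum (map (count n k) (singletonCounts n k))) (applyUpTo suc (n / 2)))
    ≡⟨ cong₂ _+_ (trans (+-identityʳ _) (count-pairFree n)) (cong sum (map-cong-local (All.tabulate pairs-summand))) ⟩
  formula n  ∎
  where
  open ≡-Reasoning
  decompose : ∀ {m f} → m ≤ n → f ≤ n ∸ m → n ≡ n ∸ m ∸ f + m + f
  decompose {m} {f} m≤n f≤n∸m = begin
    n                   ≡⟨ m∸n+n≡m m≤n ⟨
    n ∸ m + m           ≡⟨ cong (_+ m) (m∸n+n≡m f≤n∸m) ⟨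
    n ∸ m ∸ f + f + m   ≡⟨ +-assoc (n ∸ m ∸ f) f m ⟩
    n ∸ m ∸ f + (f + m) ≡⟨ cong (n ∸ m ∸ f +_) (+-comm f m) ⟩
    n ∸ m ∸ f + (m + f) ≡⟨ +-assoc (n ∸ m ∸ f) m f ⟨
    n ∸ m ∸ f + m + f   ∎
  pairs-summand : ∀ {k} → k ∈ applyUpTo suc (n / 2) →
                  sum (map (count n k) (singletonCounts n k)) ≡ sum (map (summand n k) (upTo (suc (n ∸ 2 * k))))
  pairs-summand k∈ with i , i<n/2 , refl ← ∈-applyUpTo⁻ suc k∈ =
    cong sum (map-cong-local (All.tabulate λ {f} f∈ →
      count-summand n _ i f (decompose (k≤n/2⇒2k≤n i<n/2) (m<1+n⇒m≤n (∈-upTo⁻ f∈)))))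

-- Decoding codes into set partitions

BRel : ℕ → Set
BRel n = Fin n → Fin n → Bool

Holds : BRel n → Fin n → Fin n → Set
Holds ρ i j = ρ i j ≡ true

_≗₂_ : BRel n → BRel n → Set
ρ ≗₂ σ = ∀ i j → ρ i j ≡ σ i j

tail : BRel (suc n) → BRel n
tail ρ = ρ on suc

addSingleton : BRel n → BRel (suc n)
addSingleton ρ zero    zero    = true
addSingleton ρ zero    (suc j) = false
addSingleton ρ (suc i) zero    = false
addSingleton ρ (suc i) (suc j) = ρ i j

addTo : BRel n → Fin n → BRel (suc n)
addTo ρ x = ρ on (x Vector.∷ id)

module _ {ρ : BRel n} (E : IsEquivalence (Holds ρ)) where
  open IsEquivalence E renaming (refl to ∼-refl; sym to ∼-sym; trans to ∼-trans)

  sym-≡ : ∀ i j → ρ i j ≡ ρ j i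
  sym-≡ i j = ⇔→≡ (mk⇔ ∼-sym ∼-sym)

  related⇒row≡ : ∀ {a b} → Holds ρ a b → ∀ x → ρ a x ≡ ρ b x
  related⇒row≡ a∼b x = ⇔→≡ (mk⇔ (∼-trans (∼-sym a∼b)) (∼-trans a∼b))

  addSingleton-isEquivalence : IsEquivalence (Holds (addSingleton ρ))
  addSingleton-isEquivalence = record
    { refl = λ {i} → refl′ i ; sym = λ {i} {j} → sym′ i j ; trans = λ {i} {j} {k} → trans′ i j k }
    where
    refl′ : ∀ i → Holds (addSingleton ρ) i i
    refl′ zero    = refl
    refl′ (suc i) = ∼-refl
    sym′ : ∀ i j → Holds (addSingleton ρ) i j → Holds (addSingleton ρ) j i
    sym′ zero    zero    _   = refl
    sym′ (suc i) (suc j) i∼j = ∼-sym i∼j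
    trans′ : ∀ i j k → Holds (addSingleton ρ) i j → Holds (addSingleton ρ) j k → Holds (addSingleton ρ) i k
    trans′ zero    zero    k       _   j∼k = j∼k
    trans′ (suc i) (suc j) (suc k) i∼j j∼k = ∼-trans i∼j j∼k

singletons : Code n k f e → Fin f → Fin n
singletons (singleton c)       zero    = zero
singletons (singleton c)       (suc i) = suc (singletons c i)
singletons (joinSingleton c i) j       = suc (singletons c (punchIn i j))
singletons (joinNext c)        j       = suc (singletons c j)

decode : Code n k f e → BRel n
decode nil                 = λ ()
decode (singleton c)       = addSingleton (decode c)
decode (joinSingleton c i) = addTo (decode c) (singletons c i)
decode (joinNext c)        = addTo (decode c) zero

decode-isEquivalence : (c : Code n k f e) → IsEquivalence (Holds (decode c))
decode-isEquivalence nil                 = record { refl = λ { {()} } ; sym = λ { {()} } ; trans = λ { {()} } }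
decode-isEquivalence (singleton c)       = addSingleton-isEquivalence (decode-isEquivalence c)
decode-isEquivalence (joinSingleton c i) = On.isEquivalence _ (decode-isEquivalence c)
decode-isEquivalence (joinNext c)        = On.isEquivalence _ (decode-isEquivalence c)

decode-refl : (c : Code n k f e) → ∀ i → Holds (decode c) i i
decode-refl c i = IsEquivalence.refl (decode-isEquivalence c)

IsSingleton : BRel n → Fin n → Set
IsSingleton ρ p = ∀ j → Holds ρ p j → j ≡ p

IsSingleton-suc : ∀ (ρ : BRel (suc n)) {p} → IsSingleton (tail ρ) p → ρ (suc p) zero ≡ false → IsSingleton ρ (suc p)
IsSingleton-suc ρ s p≁0 zero    p∼0 = case trans (sym p≁0) p∼0 of λ ()
IsSingleton-suc ρ s p≁0 (suc j) p∼j = cong suc (s j p∼j)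

IsSingleton-tail : ∀ (ρ : BRel (suc n)) {p} → IsSingleton ρ (suc p) → IsSingleton (tail ρ) p
IsSingleton-tail ρ s j p∼j = Fin.suc-injective (s (suc j) p∼j)

IsSingleton-unrelated : ∀ (ρ : BRel n) {p x} → IsSingleton ρ p → p ≢ x → ρ p x ≡ false
IsSingleton-unrelated ρ s p≢x = ¬-not λ p∼x → p≢x (sym (s _ p∼x))

mutual
  singletons-isSingleton : (c : Code n k f e) (i : Fin f) → IsSingleton (decode c) (singletons c i)
  singletons-isSingleton (singleton c) zero zero    _   = refl
  singletons-isSingleton (singleton c) (suc i) =
    IsSingleton-suc (decode (singleton c)) (singletons-isSingleton c i) refl
  singletons-isSingleton (joinSingleton c i) j =
    IsSingleton-suc (decode (joinSingleton c i)) (singletons-isSingleton c (punchIn i j))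
      (IsSingleton-unrelated (decode c) (singletons-isSingleton c (punchIn i j)) (punchInᵢ≢i i j ∘ singletons-injective c))
  singletons-isSingleton (joinNext c) j =
    IsSingleton-suc (decode (joinNext c)) sⱼ-single (IsSingleton-unrelated (decode c) sⱼ-single sⱼ≢0)
    where
    sⱼ-single = singletons-isSingleton c j
    sⱼ≢0 : singletons c j ≢ zero
    sⱼ≢0 sⱼ≡0 = zero-notSingleton c (subst (IsSingleton (decode c)) sⱼ≡0 sⱼ-single)

  singletons-injective : (c : Code n k f e) → ∀ {i j} → singletons c i ≡ singletons c j → i ≡ j
  singletons-injective (singleton c) {zero} {zero} _ = refl
  singletons-injective (singleton c) {suc i} {suc j} sᵢ≡sⱼ =
    cong suc (singletons-injective c (Fin.suc-injective sᵢ≡sⱼ))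
  singletons-injective (joinSingleton c x) {i} {j} sᵢ≡sⱼ =
    punchIn-injective x i j (singletons-injective c (Fin.suc-injective sᵢ≡sⱼ))
  singletons-injective (joinNext c) sᵢ≡sⱼ = singletons-injective c (Fin.suc-injective sᵢ≡sⱼ)

  zero-notSingleton : (c : Code (suc n) k f false) → ¬ IsSingleton (decode c) zero
  zero-notSingleton (joinSingleton c i) s with () ← s (suc (singletons c i)) (decode-refl c (singletons c i))
  zero-notSingleton (joinNext c)        s with () ← s (suc zero) (decode-refl c zero)

zero-isSingleton : (c : Code (suc n) k f true) → IsSingleton (decode c) zero
zero-isSingleton (singleton c) zero _ = refl

singletons-complete : (c : Code n k f e) → ∀ {p} → IsSingleton (decode c) p → ∃ λ i → singletons c i ≡ p
singletons-complete (singleton c) {zero}  s = zero , refl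
singletons-complete (singleton c) {suc p} s
  with i , refl ← singletons-complete c (IsSingleton-tail (decode (singleton c)) s) = suc i , refl
singletons-complete (joinSingleton c x) {zero} s with () ← s (suc (singletons c x)) (decode-refl c (singletons c x))
singletons-complete (joinSingleton c x) {suc p} s
  with i , refl ← singletons-complete c (IsSingleton-tail (decode (joinSingleton c x)) s) =
  punchOut x≢i , cong (suc ∘ singletons c) (punchIn-punchOut x≢i)
  where
  x≢i : x ≢ i
  x≢i refl with () ← s zero (decode-refl c (singletons c x))
singletons-complete (joinNext c) {zero}  s with () ← s (suc zero) (decode-refl c zero)
singletons-complete (joinNext c) {suc p} s
  with i , refl ← singletons-complete c (IsSingleton-tail (decode (joinNext c)) s) = i , refl

StrictlyIncreasing : ∀ {k} → (Fin k → Fin n) → Set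
StrictlyIncreasing φ = ∀ i j → i <ᶠ j → φ i <ᶠ φ j

[-]-increasing : ∀ {x : Fin n} → StrictlyIncreasing (x Vector.∷ Vector.[])
[-]-increasing zero zero ()

∷-increasing : ∀ {k} {x : Fin n} {φ : Fin (suc k) → Fin n} →
               x <ᶠ φ zero → StrictlyIncreasing φ → StrictlyIncreasing (x Vector.∷ φ)
∷-increasing x<φ₀ φ↑ zero    zero          ()
∷-increasing x<φ₀ φ↑ zero    (suc zero)    _   = x<φ₀
∷-increasing x<φ₀ φ↑ zero    (suc (suc j)) _   = Fin.<-trans x<φ₀ (φ↑ zero (suc j) z<s)
∷-increasing x<φ₀ φ↑ (suc i) zero          ()
∷-increasing x<φ₀ φ↑ (suc i) (suc j)       i<j = φ↑ i j (s<s⁻¹ i<j)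

Occurs : ∀ {k} → BRel n → (Fin k → Fin k → Bool) → (Fin k → Fin n) → Set
Occurs ρ σ φ = StrictlyIncreasing φ × (∀ i j → ρ (φ i) (φ j) ≡ σ i j)

ContainsRel : ∀ {k} → BRel n → (Fin k → Fin k → Bool) → Set
ContainsRel ρ σ = ∃ (Occurs ρ σ)

contains-tail : ∀ {k} {ρ : BRel (suc n)} {σ : Fin k → Fin k → Bool} → ContainsRel (tail ρ) σ → ContainsRel ρ σ
contains-tail (φ , φ↑ , pat) = suc ∘ φ , (λ i j i<j → s<s (φ↑ i j i<j)) , pat

occurs-lower : ∀ {k} (ρ : BRel (suc n)) {σ : Fin k → Fin k → Bool} {φ} (nz : ∀ i → zero ≢ φ i) →
               Occurs ρ σ φ → Occurs (tail ρ) σ (λ i → punchOut (nz i))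
occurs-lower ρ {φ = φ} nz (φ↑ , pat) = ψ↑ , ψ-pat
  where
  suc-ψ : ∀ i → suc (punchOut (nz i)) ≡ φ i
  suc-ψ i = punchIn-punchOut (nz i)
  ψ↑ : StrictlyIncreasing (λ i → punchOut (nz i))
  ψ↑ i j i<j = s<s⁻¹ (subst₂ _<ᶠ_ (sym (suc-ψ i)) (sym (suc-ψ j)) (φ↑ i j i<j))
  ψ-pat : ∀ i j → tail ρ (punchOut (nz i)) (punchOut (nz j)) ≡ _
  ψ-pat i j = trans (cong₂ ρ (suc-ψ i) (suc-ψ j)) (pat i j)

<⇒nonzero : ∀ {x y : Fin (suc n)} → x <ᶠ y → zero ≢ y
<⇒nonzero x<0 refl = case x<0 of λ ()

record HeadOccurrence (ρ : BRel (suc n)) : Set where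
  field
    {p q r} : Fin n
    p<q     : p <ᶠ q
    q<r     : q <ᶠ r
    0≁p     : ρ zero (suc p) ≡ false
    0∼q     : Holds ρ zero (suc q)
    0∼r     : Holds ρ zero (suc r)

contains-split : (ρ : BRel (suc n)) → ContainsRel ρ τ → ContainsRel (tail ρ) τ ⊎ HeadOccurrence ρ
contains-split ρ (φ , φ↑ , pat) with φ zero in φ₀≡
... | suc _ = inj₁ (_ , occurs-lower ρ nz (φ↑ , pat))
  where
  nz : ∀ i → zero ≢ φ i
  nz zero    0≡φ₀ = case trans 0≡φ₀ φ₀≡ of λ ()
  nz (suc i) = <⇒nonzero (φ↑ zero (suc i) z<s)
... | zero = inj₂ record
  { p<q = ψ↑ zero (suc zero) z<s
  ; q<r = ψ↑ (suc zero) (suc (suc zero)) (s<s z<s)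
  ; 0≁p = head zero
  ; 0∼q = head (suc zero)
  ; 0∼r = head (suc (suc zero))
  }
  where
  nz : ∀ i → zero ≢ φ (suc i)
  nz i = <⇒nonzero (φ↑ zero (suc i) z<s)
  occ = occurs-lower ρ nz ((λ i j i<j → φ↑ (suc i) (suc j) (s<s i<j)) , λ i j → pat (suc i) (suc j))
  ψ↑ = proj₁ occ
  head : ∀ i → ρ zero (suc (punchOut (nz i))) ≡ τ zero (suc i)
  head i = trans (cong₂ ρ (sym φ₀≡) (punchIn-punchOut (nz i))) (pat zero (suc i))

headOccurrence⇒contains : ∀ {n} {ρ : BRel (suc n)} → IsEquivalence (Holds ρ) → HeadOccurrence ρ → ContainsRel ρ τ
headOccurrence⇒contains {n} {ρ} E h = φ , φ↑ , shape
  where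
  open HeadOccurrence h
  open IsEquivalence E using () renaming (refl to ∼-refl)
  φ : Fin 4 → Fin (suc n)
  φ = zero Vector.∷ suc p Vector.∷ suc q Vector.∷ suc r Vector.∷ Vector.[]
  φ↑ : StrictlyIncreasing φ
  φ↑ = ∷-increasing z<s (∷-increasing (s<s p<q) (∷-increasing (s<s q<r) [-]-increasing))
  row-q row-r : ∀ x → ρ zero x ≡ ρ (suc _) x
  row-q = related⇒row≡ E 0∼q
  row-r = related⇒row≡ E 0∼r
  p≁0 : ρ (suc p) zero ≡ false
  p≁0 = trans (sym-≡ E _ _) 0≁p
  shape : ∀ i j → ρ (φ i) (φ j) ≡ τ i j
  shape zero                   zero                   = ∼-refl
  shape zero                   (suc zero)             = 0≁p
  shape zero                   (suc (suc zero))       = 0∼q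
  shape zero                   (suc (suc (suc zero))) = 0∼r
  shape (suc zero)             zero                   = p≁0
  shape (suc zero)             (suc zero)             = ∼-refl
  shape (suc zero)             (suc (suc zero))       = trans (sym-≡ E _ _) (trans (sym (row-q _)) 0≁p)
  shape (suc zero)             (suc (suc (suc zero))) = trans (sym-≡ E _ _) (trans (sym (row-r _)) 0≁p)
  shape (suc (suc zero))       zero                   = trans (sym (row-q zero)) ∼-refl
  shape (suc (suc zero))       (suc zero)             = trans (sym (row-q _)) 0≁p
  shape (suc (suc zero))       (suc (suc zero))       = ∼-refl
  shape (suc (suc zero))       (suc (suc (suc zero))) = trans (sym (row-q _)) 0∼r
  shape (suc (suc (suc zero))) zero                   = trans (sym (row-r zero)) ∼-refl
  shape (suc (suc (suc zero))) (suc zero)             = trans (sym (row-r _)) 0≁p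
  shape (suc (suc (suc zero))) (suc (suc zero))       = trans (sym (row-r _)) 0∼q
  shape (suc (suc (suc zero))) (suc (suc (suc zero))) = ∼-refl

decode-avoids : (c : Code n k f e) → ¬ ContainsRel (decode c) τ
decode-avoids nil (φ , _) = case φ zero of λ ()
decode-avoids (singleton c) occ with contains-split (decode (singleton c)) occ
... | inj₁ occ′ = decode-avoids c occ′
... | inj₂ h    = case HeadOccurrence.0∼q h of λ ()
decode-avoids (joinSingleton c i) occ with contains-split (decode (joinSingleton c i)) occ
... | inj₁ occ′ = decode-avoids c occ′
... | inj₂ h    = Fin.<-irrefl (trans q≡s (sym r≡s)) q<r
  where
  open HeadOccurrence h
  q≡s = singletons-isSingleton c i _ 0∼q
  r≡s = singletons-isSingleton c i _ 0∼r
-- 0 and 1 share a block, so an occurrence starting at 0 shifts to one starting at 1.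
decode-avoids (joinNext c) occ with contains-split (decode (joinNext c)) occ
... | inj₁ occ′ = decode-avoids c occ′
... | inj₂ record { p = zero ; 0≁p = 0≁0 } = case trans (sym 0≁0) (decode-refl c zero) of λ ()
... | inj₂ record { p = suc _ ; q = suc _ ; r = suc _ ; p<q = p<q ; q<r = q<r ; 0≁p = 0≁p ; 0∼q = 0∼q ; 0∼r = 0∼r } =
  decode-avoids c (headOccurrence⇒contains (decode-isEquivalence c)
    record { p<q = s<s⁻¹ p<q ; q<r = s<s⁻¹ q<r ; 0≁p = 0≁p ; 0∼q = 0∼q ; 0∼r = 0∼r })

decodeAny : AnyCode n → BRel n
decodeAny (_ , _ , _ , c) = decode c

joinSingleton≉joinNext : (c : Code (suc n) k (suc f) false) (i : Fin (suc f)) →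
                         ¬ (decode (joinSingleton c i) ≗₂ decode (joinNext c))
joinSingleton≉joinNext c i c≗c′ =
  zero-notSingleton c (subst (IsSingleton (decode c)) (sym 0≡s) (singletons-isSingleton c i))
  where
  0≡s : zero ≡ singletons c i
  0≡s = singletons-isSingleton c i zero (IsEquivalence.sym (decode-isEquivalence c)
          (trans (sym (c≗c′ zero (suc (singletons c i)))) (decode-refl c _)))

decode-injective : ∀ {k′ f′ e′} (c : Code n k f e) (c′ : Code n k′ f′ e′) → decode c ≗₂ decode c′ →
                   _≡_ {A = AnyCode n} (k , f , e , c) (k′ , f′ , e′ , c′)
decode-injective nil nil _ = refl
decode-injective (singleton c) (singleton c′) c≗c′
  with refl ← decode-injective c c′ (λ i j → c≗c′ (suc i) (suc j)) = refl
decode-injective (joinNext c) (joinNext c′) c≗c′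
  with refl ← decode-injective c c′ (λ i j → c≗c′ (suc i) (suc j)) = refl
decode-injective (joinSingleton c i) (joinSingleton c′ i′) c≗c′
  with refl ← decode-injective c c′ (λ i j → c≗c′ (suc i) (suc j))
  with refl ← singletons-injective c (singletons-isSingleton c i′ _ (trans (sym (c≗c′ zero (suc (singletons c i)))) (decode-refl c _)))
  = refl
decode-injective (joinSingleton c i) (joinNext c′) c≗c′
  with refl ← decode-injective c c′ (λ i j → c≗c′ (suc i) (suc j)) = ⊥-elim (joinSingleton≉joinNext c i c≗c′)
decode-injective (joinNext c) (joinSingleton c′ i′) c≗c′
  with refl ← decode-injective c c′ (λ i j → c≗c′ (suc i) (suc j)) =
  ⊥-elim (joinSingleton≉joinNext c i′ (λ i j → sym (c≗c′ i j)))
decode-injective (singleton c) (joinSingleton c′ i′) c≗c′ =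
  case trans (c≗c′ zero (suc (singletons c′ i′))) (decode-refl c′ _) of λ ()
decode-injective (singleton c) (joinNext c′) c≗c′ = case trans (c≗c′ zero (suc zero)) (decode-refl c′ zero) of λ ()
decode-injective (joinSingleton c i) (singleton c′) c≗c′ =
  case trans (sym (c≗c′ zero (suc (singletons c i)))) (decode-refl c _) of λ ()
decode-injective (joinNext c) (singleton c′) c≗c′ = case trans (sym (c≗c′ zero (suc zero))) (decode-refl c zero) of λ ()

≗₂-from-first-row : ∀ {ρ σ : BRel (suc n)} → IsEquivalence (Holds ρ) → IsEquivalence (Holds σ) →
                    tail ρ ≗₂ tail σ → (∀ j → ρ zero (suc j) ≡ σ zero (suc j)) → ρ ≗₂ σ
≗₂-from-first-row Eρ Eσ tail≗ row zero    zero    = trans (IsEquivalence.refl Eρ) (sym (IsEquivalence.refl Eσ))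
≗₂-from-first-row Eρ Eσ tail≗ row zero    (suc j) = row j
≗₂-from-first-row Eρ Eσ tail≗ row (suc i) zero    = trans (sym-≡ Eρ _ _) (trans (row i) (sym-≡ Eσ _ _))
≗₂-from-first-row Eρ Eσ tail≗ row (suc i) (suc j) = tail≗ i j

related-to-two⇒related-to-next : ∀ {m} (ρ : BRel (suc (suc m))) → IsEquivalence (Holds ρ) → ¬ ContainsRel ρ τ →
                                 ∀ {x y} → x ≢ y → Holds ρ zero (suc x) → Holds ρ zero (suc y) →
                                 Holds ρ zero (suc zero)
related-to-two⇒related-to-next ρ E avoids {x} {y} x≢y 0∼x 0∼y with ρ zero (suc zero) in 0≁1
... | true  = refl
... | false = ⊥-elim (avoids (headOccurrence⇒contains E (occurrence x y x≢y 0∼x 0∼y)))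
  where
  occurrence : ∀ x y → x ≢ y → Holds ρ zero (suc x) → Holds ρ zero (suc y) → HeadOccurrence ρ
  occurrence zero    _       _   0∼1 _   = case trans (sym 0≁1) 0∼1 of λ ()
  occurrence (suc _) zero    _   _   0∼1 = case trans (sym 0≁1) 0∼1 of λ ()
  occurrence (suc x) (suc y) x≢y 0∼x 0∼y with Fin.<-cmp x y
  ... | tri< x<y _ _ = record { p<q = z<s ; q<r = s<s x<y ; 0≁p = 0≁1 ; 0∼q = 0∼x ; 0∼r = 0∼y }
  ... | tri≈ _ x≡y _ = ⊥-elim (x≢y (cong suc x≡y))
  ... | tri> _ _ y<x = record { p<q = z<s ; q<r = s<s y<x ; 0≁p = 0≁1 ; 0∼q = 0∼y ; 0∼r = 0∼x }

notSingleton⇒false : (c : Code (suc n) k f e) → ¬ IsSingleton (decode c) zero → e ≡ false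
notSingleton⇒false (singleton c)       ¬s = ⊥-elim (¬s (zero-isSingleton (singleton c)))
notSingleton⇒false (joinSingleton c i) ¬s = refl
notSingleton⇒false (joinNext c)        ¬s = refl

IsSingleton-≗₂ : ∀ {ρ σ : BRel n} {p} → ρ ≗₂ σ → IsSingleton ρ p → IsSingleton σ p
IsSingleton-≗₂ ρ≗σ s j p∼j = s j (trans (ρ≗σ _ j) p∼j)

HasCode : BRel n → Set
HasCode {n} ρ = ∃ λ (C : AnyCode n) → decodeAny C ≗₂ ρ

extend-singleton : ∀ {m} (ρ : BRel (suc m)) → IsEquivalence (Holds ρ) → (c : Code m k f e) → decode c ≗₂ tail ρ →
                   (∀ j → ρ zero (suc j) ≡ false) → HasCode ρ
extend-singleton ρ E c c≗ 0≁ =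
  (_ , _ , _ , singleton c) , ≗₂-from-first-row (decode-isEquivalence (singleton c)) E c≗ (λ j → sym (0≁ j))

extend-joinSingleton : ∀ {m} (ρ : BRel (suc m)) → IsEquivalence (Holds ρ) → (c : Code m k f e) → decode c ≗₂ tail ρ →
                       ∀ {j} → Holds ρ zero (suc j) → IsSingleton (tail ρ) j → HasCode ρ
extend-joinSingleton ρ E c c≗ {j} 0∼j j-single
  with singletons-complete c (IsSingleton-≗₂ (λ a b → sym (c≗ a b)) j-single)
extend-joinSingleton {f = suc _} ρ E c c≗ {j} 0∼j j-single | i , sᵢ≡j =
  (_ , _ , _ , joinSingleton c i) , ≗₂-from-first-row (decode-isEquivalence (joinSingleton c i)) E c≗ first-row
  where
  first-row : ∀ x → decode c (singletons c i) x ≡ ρ zero (suc x)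
  first-row x = trans (cong (λ y → decode c y x) sᵢ≡j) (trans (c≗ j x) (sym (related⇒row≡ E 0∼j (suc x))))

second-notSingleton : ∀ {m} (ρ : BRel (suc (suc m))) → IsEquivalence (Holds ρ) → ¬ ContainsRel ρ τ →
                      ∀ {j q} → q ≢ j → Holds ρ zero (suc j) → Holds ρ (suc j) (suc q) →
                      Holds ρ zero (suc zero) × ¬ IsSingleton (tail ρ) zero
second-notSingleton ρ E avoids {j} {q} q≢j 0∼j j∼q =
  0∼1 , λ s → q≢j (trans (s q (1∼ q 0∼q)) (sym (s j (1∼ j 0∼j))))
  where
  open IsEquivalence E using () renaming (trans to ∼-trans)
  0∼q = ∼-trans 0∼j j∼q
  0∼1 = related-to-two⇒related-to-next ρ E avoids q≢j 0∼q 0∼j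
  1∼ : ∀ x → Holds ρ zero (suc x) → Holds (tail ρ) zero x
  1∼ x 0∼x = trans (sym (related⇒row≡ E 0∼1 (suc x))) 0∼x

extend-joinNext : ∀ {m} (ρ : BRel (suc m)) → IsEquivalence (Holds ρ) → ¬ ContainsRel ρ τ →
                  (c : Code m k f e) → decode c ≗₂ tail ρ →
                  ∀ {j q} → q ≢ j → Holds ρ zero (suc j) → Holds ρ (suc j) (suc q) → HasCode ρ
extend-joinNext {m = zero}  ρ E avoids c c≗ {()}
extend-joinNext {m = suc m} ρ E avoids c c≗ q≢j 0∼j j∼q
  with 0∼1 , 1-notSingleton ← second-notSingleton ρ E avoids q≢j 0∼j j∼q
  with refl ← notSingleton⇒false c (1-notSingleton ∘ IsSingleton-≗₂ c≗) =
  (_ , _ , _ , joinNext c) ,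
  ≗₂-from-first-row (decode-isEquivalence (joinNext c)) E c≗
    λ x → trans (c≗ zero x) (sym (related⇒row≡ E 0∼1 (suc x)))

decode-surjective : ∀ n (ρ : BRel n) → IsEquivalence (Holds ρ) → ¬ ContainsRel ρ τ → HasCode ρ
decode-surjective zero    ρ E avoids = (0 , 0 , true , nil) , λ ()
decode-surjective (suc m) ρ E avoids
  with (_ , _ , _ , c) , c≗ ← decode-surjective m (tail ρ) (On.isEquivalence suc E) (avoids ∘ contains-tail {ρ = ρ})
  with any? (λ j → ρ zero (suc j) Bool.≟ true)
... | no ¬0∼ = extend-singleton ρ E c c≗ (λ j → ¬-not (¬0∼ ∘ (j ,_)))
... | yes (j , 0∼j) with any? (λ q → (ρ (suc j) (suc q) Bool.≟ true) ×-dec ¬? (q Fin.≟ j))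
...   | yes (q , j∼q , q≢j) = extend-joinNext ρ E avoids c c≗ q≢j 0∼j j∼q
...   | no ¬other = extend-joinSingleton ρ E c c≗ 0∼j j-single
  where
  j-single : IsSingleton (tail ρ) j
  j-single q j∼q with q Fin.≟ j
  ... | yes q≡j = q≡j
  ... | no  q≢j = ⊥-elim (¬other (q , j∼q , q≢j))

-- Boolean matrices

HasCard-image : ∀ {A B : Set} {P : A → Set} (g : B → A) (xs : List B) → Unique xs → (∀ b → b ∈ xs) →
                (∀ {b b′} → g b ≡ g b′ → b ≡ b′) → (∀ b → P (g b)) → (∀ a → P a → ∃ λ b → g b ≡ a) →
                HasCard P (length xs)
HasCard-image g xs xs! xs-complete g-injective g-valid g-onto =
  map g xs , Unique.map⁺ g-injective xs! , All.tabulate valid , complete , length-map g xs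
  where
  valid : ∀ {a} → a ∈ map g xs → _
  valid a∈ with b , _ , refl ← ∈-map⁻ g a∈ = g-valid b
  complete : ∀ a → _ → a ∈ map g xs
  complete a Pa with b , refl ← g-onto a Pa = ∈-map⁺ g (xs-complete b)

toMat : BRel n → Mat n
toMat ρ = tabulate (λ i → tabulate (ρ i))

rel-toMat : ∀ (ρ : BRel n) i j → rel (toMat ρ) i j ≡ ρ i j
rel-toMat ρ i j =
  trans (cong (λ row → lookup row j) (lookup∘tabulate (λ i → tabulate (ρ i)) i)) (lookup∘tabulate (ρ i) j)

toMat-rel : ∀ (M : Mat n) → toMat (rel M) ≡ M
toMat-rel M = trans (tabulate-cong (λ i → tabulate∘lookup (lookup M i))) (tabulate∘lookup M)

toMat-cong : ∀ {ρ σ : BRel n} → ρ ≗₂ σ → toMat ρ ≡ toMat σ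
toMat-cong ρ≗σ = tabulate-cong (λ i → tabulate-cong (ρ≗σ i))

toMat-injective : ∀ {ρ σ : BRel n} → toMat ρ ≡ toMat σ → ρ ≗₂ σ
toMat-injective {ρ = ρ} {σ} eq i j = trans (sym (rel-toMat ρ i j)) (trans (cong (λ M → rel M i j) eq) (rel-toMat σ i j))

toMat-isSetPartition : ∀ {ρ : BRel n} → IsEquivalence (Holds ρ) → IsSetPartition (toMat ρ)
toMat-isSetPartition {ρ = ρ} E = record
  { refl  = λ _ → from ∼-refl
  ; sym   = λ _ _ → from ∘ ∼-sym ∘ to
  ; trans = λ _ _ _ i∼j j∼k → from (∼-trans (to i∼j) (to j∼k))
  }
  where
  open IsEquivalence E renaming (refl to ∼-refl; sym to ∼-sym; trans to ∼-trans)
  to : ∀ {i j} → Holds (rel (toMat ρ)) i j → Holds ρ i j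
  to {i} {j} = trans (sym (rel-toMat ρ i j))
  from : ∀ {i j} → Holds ρ i j → Holds (rel (toMat ρ)) i j
  from {i} {j} = trans (rel-toMat ρ i j)

isSetPartition⇒isEquivalence : ∀ {M : Mat n} → IsSetPartition M → IsEquivalence (Holds (rel M))
isSetPartition⇒isEquivalence P = record
  { refl = IsSetPartition.refl P _ ; sym = IsSetPartition.sym P _ _ ; trans = IsSetPartition.trans P _ _ _ }

toMat-avoids : ∀ {ρ : BRel n} {k} {σ : Fin k → Fin k → Bool} → ¬ ContainsRel ρ σ → Avoids (toMat ρ) σ
toMat-avoids {ρ = ρ} avoids (φ , φ↑ , pat) =
  avoids (φ , φ↑ , λ i j → trans (sym (rel-toMat ρ (φ i) (φ j))) (pat i j))

theorem4p13 : (n : ℕ) → n ≥ 1 →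
    HasCard (λ (M : Mat n) → IsSetPartition M × Avoids M τ) (formula n)
theorem4p13 n _ = subst (HasCard _) (length-allCodes n)
  (HasCard-image (toMat ∘ decodeAny) (allCodes n) (allCodes-unique n) (allCodes-complete n) injective valid onto)
  where
  injective : ∀ {C C′ : AnyCode n} → toMat (decodeAny C) ≡ toMat (decodeAny C′) → C ≡ C′
  injective {_ , _ , _ , c} {_ , _ , _ , c′} eq = decode-injective c c′ (toMat-injective eq)
  valid : ∀ C → IsSetPartition (toMat (decodeAny C)) × Avoids (toMat (decodeAny C)) τ
  valid (_ , _ , _ , c) = toMat-isSetPartition (decode-isEquivalence c) , toMat-avoids (decode-avoids c)
  onto : ∀ M → IsSetPartition M × Avoids M τ → ∃ λ C → toMat (decodeAny C) ≡ M
  onto M (P , avoids) with C , C≗M ← decode-surjective n (rel M) (isSetPartition⇒isEquivalence P) avoids =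
    C , trans (toMat-cong C≗M) (toMat-rel M)
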